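{- Suppose there is a streaming algorithm that properly edge colors any $n$-vertex bipartite graph of maximum degree $\Delta$ under one-sided vertex arrivals using $f(\Delta)$ colors. Then there is a streaming algorithm that properly edge colors any $n$-vertex bipartite graph of maximum degree $\Delta$ under two-sided vertex arrivals using $2f(\Delta)$ colors and asymptotically the same space.
   Context: One-sided vertex arrivals: the input graph is bipartite with parts $U$ and $V$; the offline vertices $V$ are present from the start, and the online vertices in $U$ arrive one by one in arbitrary order, and when $u\in U$ arrives all its edges to $V$ are revealed. Two-sided vertex arrivals: the vertex arrival model on a bipartite graph, i.e., vertices from both parts arrive one by one in arbitrary order and upon arrival of a vertex all its edges to previously arrived vertices are revealed. Edge colors are reported in a streaming fashion; a proper edge coloring gives adjacent edges distinct colors. -}

module Defs where

open import Data.Nat using (ℕ; _≤_; _*_; _+_)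
open import Data.Fin using (Fin; _≟_)
open import Data.Bool using (Bool)
open import Data.Vec using (Vec)
open import Data.List using (List; []; _∷_; map; concatMap; length; filter; lookup; _++_)
open import Data.List.Membership.Propositional using (_∈_; _∉_)
open import Data.List.Relation.Unary.All using (All)
open import Data.List.Relation.Unary.Any using (Any)
open import Data.List.Relation.Unary.Unique.Propositional using (Unique)
open import Data.Product using (Σ; _×_; _,_; proj₁; proj₂)
open import Data.Sum using (_⊎_)
open import Data.Unit using (⊤)
open import Relation.Binary.PropositionalEquality using (_≡_; _≢_)
open import Relation.Nullary.Decidable using (_⊎-dec_)

-- Outputs are write-only and are not counted as memory.

record StreamAlg (I O : Set) (s : ℕ) : Set where
  field
    init   : Vec Bool s
    step   : Vec Bool s → I → Vec Bool s × List O
    finish : Vec Bool s → List O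

open StreamAlg public

runFrom : ∀ {I O s} → StreamAlg I O s → Vec Bool s → List I → List O
runFrom A st []       = finish A st
runFrom A st (x ∷ xs) = proj₂ (step A st x) ++ runFrom A (proj₁ (step A st x)) xs

run : ∀ {I O s} → StreamAlg I O s → List I → List O
run A xs = runFrom A (init A) xs

Edge : ℕ → Set
Edge n = Fin n × Fin n

ColoredEdge : ℕ → ℕ → Set
ColoredEdge n k = Fin n × Fin n × Fin k

Incident : ∀ {n} → Fin n → Edge n → Set
Incident v (a , b) = (a ≡ v) ⊎ (b ≡ v)

degree : ∀ {n} → List (Edge n) → Fin n → ℕ
degree E v = length (filter (λ e → (proj₁ e ≟ v) ⊎-dec (proj₂ e ≟ v)) E)

MaxDegreeAtMost : ∀ {n} → ℕ → List (Edge n) → Set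
MaxDegreeAtMost {n} Δ E = (v : Fin n) → degree E v ≤ Δ

Reports : ∀ {n k} → ColoredEdge n k → Edge n → Set
Reports (x , y , c) (a , b) = ((x ≡ a) × (y ≡ b)) ⊎ ((x ≡ b) × (y ≡ a))

ShareEndpoint : ∀ {n k} → ColoredEdge n k → ColoredEdge n k → Set
ShareEndpoint (x , y , _) (x' , y' , _) =
  (x ≡ x') ⊎ (x ≡ y') ⊎ (y ≡ x') ⊎ (y ≡ y')

color : ∀ {n k} → ColoredEdge n k → Fin k
color (_ , _ , c) = c

ProperColoringOutput : ∀ {n k} → List (Edge n) → List (ColoredEdge n k) → Set
ProperColoringOutput E O =
  All (λ e → Any (λ o → Reports o e) O ×
             ((i j : Fin (length O)) → Reports (lookup O i) e →
                Reports (lookup O j) e → i ≡ j)) E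
  × All (λ o → Any (λ e → Reports o e) E) O
  × ((i j : Fin (length O)) → i ≢ j →
       ShareEndpoint (lookup O i) (lookup O j) →
       color (lookup O i) ≢ color (lookup O j))

-- One-sided vertex arrivals.
-- A stream item is an online vertex u (its id) together with the list
-- of its neighbours, all of which are offline vertices.

OneArrival : ℕ → Set
OneArrival n = Fin n × List (Fin n)

edges₁ : ∀ {n} → List (OneArrival n) → List (Edge n)
edges₁ = concatMap (λ a → map (λ v → (proj₁ a , v)) (proj₂ a))

ValidOneSided : ∀ {n} → ℕ → List (OneArrival n) → Set
ValidOneSided Δ σ =
  Unique (map proj₁ σ)
  × All (λ a → Unique (proj₂ a)) σ
  × All (λ a → All (λ v → v ∉ map proj₁ σ) (proj₂ a)) σ
  × MaxDegreeAtMost Δ (edges₁ σ)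

OneSidedAlg : ℕ → ℕ → ℕ → Set
OneSidedAlg n k s = StreamAlg (OneArrival n) (ColoredEdge n k) s

OneSidedCorrect : ∀ {n k s} → ℕ → OneSidedAlg n k s → Set
OneSidedCorrect {n} Δ A =
  (σ : List (OneArrival n)) → ValidOneSided Δ σ →
  ProperColoringOutput (edges₁ σ) (run A σ)

-- Two-sided vertex arrivals.
-- A stream item is a vertex w (its id), its part (U or V), and the list
-- of its neighbours among the previously arrived vertices.

data Side : Set where
  sideU sideV : Side

opposite : Side → Side
opposite sideU = sideV
opposite sideV = sideU

TwoArrival : ℕ → Set
TwoArrival n = Fin n × Side × List (Fin n)

edges₂ : ∀ {n} → List (TwoArrival n) → List (Edge n)
edges₂ = concatMap (λ a → map (λ v → (proj₁ a , v)) (proj₂ (proj₂ a)))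

ValidArrivals : ∀ {n} → List (Fin n × Side) → List (TwoArrival n) → Set
ValidArrivals prev [] = ⊤
ValidArrivals prev ((w , sd , ns) ∷ rest) =
  w ∉ map proj₁ prev
  × Unique ns
  × All (λ x → (x , opposite sd) ∈ prev) ns
  × ValidArrivals (prev ++ ((w , sd) ∷ [])) rest

ValidTwoSided : ∀ {n} → ℕ → List (TwoArrival n) → Set
ValidTwoSided Δ σ = ValidArrivals [] σ × MaxDegreeAtMost Δ (edges₂ σ)

TwoSidedAlg : ℕ → ℕ → ℕ → Set
TwoSidedAlg n k s = StreamAlg (TwoArrival n) (ColoredEdge n k) s

TwoSidedCorrect : ∀ {n k s} → ℕ → TwoSidedAlg n k s → Set
TwoSidedCorrect {n} Δ A =
  (σ : List (TwoArrival n)) → ValidTwoSided Δ σ →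
  ProperColoringOutput (edges₂ σ) (run A σ)

{-# OPTIONS --safe #-}
-- Run two copies of the one-sided algorithm side by side in separate memory: the arrivals of
-- U-vertices, with their neighbour lists, go to the first copy and those of V-vertices to the
-- second. Neighbours are always earlier vertices of the other side, so each copy sees a valid
-- one-sided stream, namely of the subgraph of edges whose later endpoint lies on its side.
-- Every edge is revealed exactly once, at the arrival of its later endpoint, so these two
-- subgraphs partition the graph; colouring them from two disjoint palettes of f(Δ) colours
-- gives a proper colouring with 2 f(Δ) colours, in the memory of the two copies.
module Submission where

open import Defs
open import Data.Nat using (ℕ; _+_; _*_)
open import Data.Nat.Properties using (+-identityʳ; ≤-trans)
open import Data.Bool using (Bool; true; false)
open import Data.Fin using (Fin; zero; suc; _↑ˡ_; _↑ʳ_; splitAt; _≟_)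
open import Data.Fin.Properties using (suc-injective; ↑ˡ-injective; ↑ʳ-injective; splitAt-↑ˡ; splitAt-↑ʳ)
open import Data.Vec using (Vec; take; drop; replicate) renaming (_++_ to _++ᵛ_)
open import Data.Vec.Properties using (take++drop≡id; ++-injective)
open import Data.List using (List; []; _∷_; _++_; map; filter; lookup; concat)
open import Data.List.Properties using (map-++; map-∘; ++-assoc)
open import Data.List.Membership.Propositional using (_∈_; _∉_; find)
open import Data.List.Membership.Propositional.Properties using (∈-lookup; ∈-map⁺; ∈-map⁻; ∈-++⁺ˡ; ∈-++⁺ʳ; ∈-filter⁻)
open import Data.List.Relation.Unary.All as All using (All; []; _∷_)
import Data.List.Relation.Unary.All.Properties as All
open import Data.List.Relation.Unary.Any as Any using (Any; here; there)
import Data.List.Relation.Unary.Any.Properties as Any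
open import Data.List.Relation.Unary.AllPairs as AllPairs using (AllPairs; []; _∷_)
import Data.List.Relation.Unary.AllPairs.Properties as AllPairs
open import Data.List.Relation.Unary.Unique.Propositional using (Unique)
open import Data.List.Relation.Ternary.Interleaving.Propositional using (Interleaving; consˡ; consʳ; toPermutation)
open import Data.List.Relation.Ternary.Interleaving using ([])
open import Data.List.Relation.Binary.Sublist.Propositional using (_⊆_; []; _∷_; _∷ʳ_)
import Data.List.Relation.Binary.Sublist.Propositional.Properties as Sublist
open import Data.List.Relation.Binary.Permutation.Propositional using (_↭_; ↭-sym; ↭⇒↭ₛ)
open import Data.List.Relation.Binary.Permutation.Propositional.Properties using (All-resp-↭; Any-resp-↭)
import Data.List.Relation.Binary.Permutation.Setoid.Properties as PermutationSetoid
open import Data.Product using (Σ; _×_; _,_; proj₁; proj₂; map₁; map₂)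
open import Data.Sum using (_⊎_; inj₁; inj₂)
open import Data.Empty using (⊥-elim)
open import Function using (_∘_)
open import Function.Definitions using (Injective)
open import Relation.Nullary using (¬_; yes; no; ¬?; does)
open import Relation.Unary using (Pred; Decidable)
open import Level using (0ℓ)
open import Relation.Binary using (Rel; Symmetric)
open import Relation.Binary.PropositionalEquality
  using (_≡_; _≢_; refl; sym; trans; cong; subst; subst₂; setoid; resp₂; module ≡-Reasoning)

private
  variable
    A B I J O : Set
    s s₁ s₂ : ℕ

lookup⇒AllPairs : {R : Rel A 0ℓ} {xs : List A} →
  (∀ i j → i ≢ j → R (lookup xs i) (lookup xs j)) → AllPairs R xs
lookup⇒AllPairs {xs = []}     _ = []
lookup⇒AllPairs {R = R} {xs = x ∷ xs} R-lookup =
  All.tabulate (λ y∈xs → subst (R x) (sym (Any.lookup-index y∈xs)) (R-lookup zero (suc (Any.index y∈xs)) λ ()))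
  ∷ lookup⇒AllPairs (λ i j i≢j → R-lookup (suc i) (suc j) (i≢j ∘ suc-injective))

AllPairs⇒lookup : {R : Rel A 0ℓ} {xs : List A} → Symmetric R →
  AllPairs R xs → ∀ i j → i ≢ j → R (lookup xs i) (lookup xs j)
AllPairs⇒lookup R-sym (_ ∷ _)      zero    zero    0≢0 = ⊥-elim (0≢0 refl)
AllPairs⇒lookup R-sym (Rx ∷ _)     zero    (suc j) _   = All.lookup Rx (∈-lookup j)
AllPairs⇒lookup R-sym (Rx ∷ _)     (suc i) zero    _   = R-sym (All.lookup Rx (∈-lookup i))
AllPairs⇒lookup R-sym (_ ∷ R-xs)   (suc i) (suc j) i≢j = AllPairs⇒lookup R-sym R-xs i j (i≢j ∘ cong suc)

Unique-map⇒injective : {f : A → B} {xs : List A} {x y : A} →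
  Unique (map f xs) → x ∈ xs → y ∈ xs → f x ≡ f y → x ≡ y
Unique-map⇒injective (_ ∷ _)     (here refl) (here refl) _ = refl
Unique-map⇒injective (fx∉ ∷ _)   (here refl) (there y∈)  fx≡fy = ⊥-elim (All.lookup fx∉ (∈-map⁺ _ y∈) fx≡fy)
Unique-map⇒injective (fy∉ ∷ _)   (there x∈)  (here refl) fx≡fy = ⊥-elim (All.lookup fy∉ (∈-map⁺ _ x∈) (sym fx≡fy))
Unique-map⇒injective (_ ∷ u)     (there x∈)  (there y∈)  fx≡fy = Unique-map⇒injective u x∈ y∈ fx≡fy

∈-map-++⁺ˡ : ∀ (f : A → B) {xs ys y} → y ∈ map f xs → y ∈ map f (xs ++ ys)
∈-map-++⁺ˡ f {xs} {ys} y∈ = subst (_ ∈_) (sym (map-++ f xs ys)) (∈-++⁺ˡ y∈)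

∈-map-++⁺ʳ : ∀ (f : A → B) xs {ys y} → y ∈ map f ys → y ∈ map f (xs ++ ys)
∈-map-++⁺ʳ f xs {ys} y∈ = subst (_ ∈_) (sym (map-++ f xs ys)) (∈-++⁺ʳ (map f xs) y∈)

AllPairs-++⁻ : {R : Rel A 0ℓ} (xs : List A) {ys : List A} → AllPairs R (xs ++ ys) → All (λ x → All (R x) ys) xs
AllPairs-++⁻ []       _              = []
AllPairs-++⁻ (x ∷ xs) (Rx ∷ R-rest) = All.++⁻ʳ xs Rx ∷ AllPairs-++⁻ xs R-rest

module _ {A : Set} where

  prependˡ : ∀ (xs : List A) {l r zs} → Interleaving l r zs → Interleaving (xs ++ l) r (xs ++ zs)
  prependˡ []       sp = sp
  prependˡ (x ∷ xs) sp = consˡ (prependˡ xs sp)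

  prependʳ : ∀ (xs : List A) {l r zs} → Interleaving l r zs → Interleaving l (xs ++ r) (xs ++ zs)
  prependʳ []       sp = sp
  prependʳ (x ∷ xs) sp = consʳ (prependʳ xs sp)

  Interleaving-++ : ∀ (l r : List A) → Interleaving l r (l ++ r)
  Interleaving-++ []      []      = []
  Interleaving-++ []      (x ∷ r) = consʳ (Interleaving-++ [] r)
  Interleaving-++ (x ∷ l) r       = consˡ (Interleaving-++ l r)

  Interleaving⇒⊆ˡ : ∀ {l r zs : List A} → Interleaving l r zs → l ⊆ zs
  Interleaving⇒⊆ˡ []         = []
  Interleaving⇒⊆ˡ (consˡ sp) = refl ∷ Interleaving⇒⊆ˡ sp
  Interleaving⇒⊆ˡ (consʳ sp) = _ ∷ʳ Interleaving⇒⊆ˡ sp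

AllPairs-Interleaving⁻ : {R : Rel A 0ℓ} {l r zs : List A} → Symmetric R →
  Interleaving l r zs → AllPairs R zs → All (λ x → All (R x) r) l
AllPairs-Interleaving⁻ {A = A} {l = l} R-sym l⋎r =
  AllPairs-++⁻ l ∘ AllPairs-resp-↭ R-sym (resp₂ _) (↭⇒↭ₛ (toPermutation l⋎r))
  where open PermutationSetoid (setoid A) using (AllPairs-resp-↭)

-- Combinators on streaming algorithms

take-++ : ∀ {m n} (a : Vec A m) (b : Vec A n) → take m (a ++ᵛ b) ≡ a
take-++ {m = m} a b = proj₁ (++-injective (take m (a ++ᵛ b)) a (take++drop≡id m (a ++ᵛ b)))

drop-++ : ∀ {m n} (a : Vec A m) (b : Vec A n) → drop m (a ++ᵛ b) ≡ b
drop-++ {m = m} a b = proj₂ (++-injective (take m (a ++ᵛ b)) a (take++drop≡id m (a ++ᵛ b)))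

mapOutput : (O → J) → StreamAlg I O s → StreamAlg I J s
mapOutput g A = record
  { init   = init A
  ; step   = λ st x → map₂ (map g) (step A st x)
  ; finish = map g ∘ finish A
  }

runFrom-mapOutput : ∀ (g : O → J) (A : StreamAlg I O s) st xs →
  runFrom (mapOutput g A) st xs ≡ map g (runFrom A st xs)
runFrom-mapOutput g A st []       = refl
runFrom-mapOutput g A st (x ∷ xs) = begin
  map g out ++ runFrom (mapOutput g A) st′ xs  ≡⟨ cong (map g out ++_) (runFrom-mapOutput g A st′ xs) ⟩
  map g out ++ map g (runFrom A st′ xs)        ≡⟨ map-++ g out _ ⟨
  map g (out ++ runFrom A st′ xs)              ∎
  where
  open ≡-Reasoning
  st′ = proj₁ (step A st x)
  out = proj₂ (step A st x)

pad : ∀ t → StreamAlg I O s → StreamAlg I O (s + t)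
pad {s = s} t A = record
  { init   = init A ++ᵛ replicate t false
  ; step   = λ st x → map₁ (_++ᵛ drop s st) (step A (take s st) x)
  ; finish = finish A ∘ take s
  }

runFrom-pad : ∀ t (A : StreamAlg I O s) a b xs → runFrom (pad t A) (a ++ᵛ b) xs ≡ runFrom A a xs
runFrom-pad t A a b [] = cong (finish A) (take-++ a b)
runFrom-pad t A a b (x ∷ xs) rewrite take-++ a b | drop-++ a b =
  cong (proj₂ (step A a x) ++_) (runFrom-pad t A (proj₁ (step A a x)) b xs)

module Parallel {P : Pred I 0ℓ} (P? : Decidable P) (g : I → J)
                (A₁ : StreamAlg J O s₁) (A₂ : StreamAlg J O s₂) where

  dispatch : Vec Bool (s₁ + s₂) → I → Vec Bool (s₁ + s₂) × List O
  dispatch st x with does (P? x)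
  ... | true  = map₁ (_++ᵛ drop s₁ st) (step A₁ (take s₁ st) (g x))
  ... | false = map₁ (take s₁ st ++ᵛ_) (step A₂ (drop s₁ st) (g x))

  parallel : StreamAlg I O (s₁ + s₂)
  parallel = record
    { init   = init A₁ ++ᵛ init A₂
    ; step   = dispatch
    ; finish = λ st → finish A₁ (take s₁ st) ++ finish A₂ (drop s₁ st)
    }

  runFrom-parallel : ∀ a b xs →
    Interleaving (runFrom A₁ a (map g (filter P? xs))) (runFrom A₂ b (map g (filter (¬? ∘ P?) xs)))
                 (runFrom parallel (a ++ᵛ b) xs)
  runFrom-parallel a b [] rewrite take-++ a b | drop-++ a b = Interleaving-++ _ _
  runFrom-parallel a b (x ∷ xs) with does (P? x)
  ... | true  rewrite take-++ a b | drop-++ a b =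
    prependˡ (proj₂ (step A₁ a (g x))) (runFrom-parallel (proj₁ (step A₁ a (g x))) b xs)
  ... | false rewrite take-++ a b | drop-++ a b =
    prependʳ (proj₂ (step A₂ b (g x))) (runFrom-parallel a (proj₁ (step A₂ b (g x))) xs)

-- Proper edge colourings

module _ {n : ℕ} where

  SameEdge : Edge n → Edge n → Set
  SameEdge (a , b) (a′ , b′) = (a ≡ a′ × b ≡ b′) ⊎ (a ≡ b′ × b ≡ a′)

  SameEdge-sym : Symmetric SameEdge
  SameEdge-sym (inj₁ (refl , refl)) = inj₁ (refl , refl)
  SameEdge-sym (inj₂ (refl , refl)) = inj₂ (refl , refl)

  SameEdge-trans : {e e′ e″ : Edge n} → SameEdge e e′ → SameEdge e′ e″ → SameEdge e e″
  SameEdge-trans (inj₁ (refl , refl)) s                    = s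
  SameEdge-trans (inj₂ (refl , refl)) (inj₁ (refl , refl)) = inj₂ (refl , refl)
  SameEdge-trans (inj₂ (refl , refl)) (inj₂ (refl , refl)) = inj₁ (refl , refl)

module _ {n k : ℕ} where

  ends : ColoredEdge n k → Edge n
  ends (x , y , _) = x , y

  DistinctEdges : Rel (ColoredEdge n k) 0ℓ
  DistinctEdges o o′ = ¬ SameEdge (ends o) (ends o′)

  ColorsDiffer : Rel (ColoredEdge n k) 0ℓ
  ColorsDiffer o o′ = ShareEndpoint o o′ → color o ≢ color o′

  -- DistinctEdges ignores colours, so uses of DistinctEdges-sym must supply its implicit arguments.
  DistinctEdges-sym : Symmetric DistinctEdges
  DistinctEdges-sym distinct same = distinct (SameEdge-sym same)

  ShareEndpoint-sym : {o o′ : ColoredEdge n k} → ShareEndpoint o o′ → ShareEndpoint o′ o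
  ShareEndpoint-sym (inj₁ eq)               = inj₁ (sym eq)
  ShareEndpoint-sym (inj₂ (inj₁ eq))        = inj₂ (inj₂ (inj₁ (sym eq)))
  ShareEndpoint-sym (inj₂ (inj₂ (inj₁ eq))) = inj₂ (inj₁ (sym eq))
  ShareEndpoint-sym (inj₂ (inj₂ (inj₂ eq))) = inj₂ (inj₂ (inj₂ (sym eq)))

  ColorsDiffer-sym : Symmetric ColorsDiffer
  ColorsDiffer-sym {o} {o′} differ share = differ (ShareEndpoint-sym {o′} {o} share) ∘ sym

  record ProperColoring (E : List (Edge n)) (O : List (ColoredEdge n k)) : Set where
    field
      complete      : All (λ e → Any (λ o → Reports o e) O) E
      sound         : All (λ o → Any (Reports o) E) O
      distinctEdges : AllPairs DistinctEdges O
      colorsDiffer  : AllPairs ColorsDiffer O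

open ProperColoring

module _ {n k : ℕ} where

  ProperColoringOutput⇒ProperColoring : ∀ {E} {O : List (ColoredEdge n k)} → ProperColoringOutput E O → ProperColoring E O
  ProperColoringOutput⇒ProperColoring {E} {O} (once , sound , proper) = record
    { complete      = All.map proj₁ once
    ; sound         = sound
    ; distinctEdges = lookup⇒AllPairs distinct
    ; colorsDiffer  = lookup⇒AllPairs proper
    }
    where
    distinct : ∀ i j → i ≢ j → DistinctEdges (lookup O i) (lookup O j)
    distinct i j i≢j same with find (All.lookup sound (∈-lookup i))
    ... | e , e∈E , reportsᵢ =
      i≢j (proj₂ (All.lookup once e∈E) i j reportsᵢ (SameEdge-trans (SameEdge-sym same) reportsᵢ))

  ProperColoring⇒ProperColoringOutput : ∀ {E} {O : List (ColoredEdge n k)} → ProperColoring E O → ProperColoringOutput E O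
  ProperColoring⇒ProperColoringOutput {E} {O} proper =
    All.map (_, once _) (complete proper) , sound proper ,
    AllPairs⇒lookup ColorsDiffer-sym (colorsDiffer proper)
    where
    distinct : ∀ i j → i ≢ j → DistinctEdges (lookup O i) (lookup O j)
    distinct = AllPairs⇒lookup (λ {o} {o′} → DistinctEdges-sym {x = o} {y = o′}) (distinctEdges proper)

    once : ∀ e i j → Reports (lookup O i) e → Reports (lookup O j) e → i ≡ j
    once e i j reportsᵢ reportsⱼ with i ≟ j
    ... | yes i≡j = i≡j
    ... | no  i≢j = ⊥-elim (distinct i j i≢j (SameEdge-trans reportsᵢ (SameEdge-sym reportsⱼ)))

↑ˡ≢↑ʳ : ∀ {m m′} (i : Fin m) (j : Fin m′) → i ↑ˡ m′ ≢ m ↑ʳ j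
↑ˡ≢↑ʳ {m} {m′} i j eq with trans (sym (splitAt-↑ˡ m i m′)) (trans (cong (splitAt m) eq) (splitAt-↑ʳ m m′ j))
... | ()

module _ {n k k′ : ℕ} where

  recolor : (Fin k → Fin k′) → ColoredEdge n k → ColoredEdge n k′
  recolor c (x , y , i) = x , y , c i

  ProperColoring-recolor : ∀ {c : Fin k → Fin k′} {E O} → Injective _≡_ _≡_ c →
    ProperColoring E O → ProperColoring E (map (recolor c) O)
  ProperColoring-recolor c-injective proper = record
    { complete      = All.map Any.map⁺ (complete proper)
    ; sound         = All.map⁺ (sound proper)
    ; distinctEdges = AllPairs.map⁺ (distinctEdges proper)
    ; colorsDiffer  = AllPairs.map⁺ (AllPairs.map (λ differ share → differ share ∘ c-injective) (colorsDiffer proper))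
    }

module _ {n k : ℕ} where

  ProperColoring-++ : ∀ {E₁ E₂} {O₁ O₂ : List (ColoredEdge n k)} → ProperColoring E₁ O₁ → ProperColoring E₂ O₂ →
    All (λ e₁ → All (λ e₂ → ¬ SameEdge e₁ e₂) E₂) E₁ →
    All (λ o₁ → All (λ o₂ → color o₁ ≢ color o₂) O₂) O₁ →
    ProperColoring (E₁ ++ E₂) (O₁ ++ O₂)
  ProperColoring-++ {E₁} {E₂} {O₁} {O₂} proper₁ proper₂ edges-disjoint colors-disjoint = record
    { complete      = All.++⁺ (All.map Any.++⁺ˡ (complete proper₁)) (All.map (Any.++⁺ʳ O₁) (complete proper₂))
    ; sound         = All.++⁺ (All.map Any.++⁺ˡ (sound proper₁)) (All.map (Any.++⁺ʳ E₁) (sound proper₂))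
    ; distinctEdges = AllPairs.++⁺ (distinctEdges proper₁) (distinctEdges proper₂)
                        (All.tabulate λ o₁∈ → All.tabulate λ o₂∈ → distinct o₁∈ o₂∈)
    ; colorsDiffer  = AllPairs.++⁺ (colorsDiffer proper₁) (colorsDiffer proper₂)
                        (All.map (All.map λ c₁≢c₂ _ → c₁≢c₂) colors-disjoint)
    }
    where
    distinct : ∀ {o₁ o₂} → o₁ ∈ O₁ → o₂ ∈ O₂ → DistinctEdges o₁ o₂
    distinct {o₁} {o₂} o₁∈ o₂∈ same with find (All.lookup (sound proper₁) o₁∈) | find (All.lookup (sound proper₂) o₂∈)
    ... | e₁ , e₁∈ , reports₁ | e₂ , e₂∈ , reports₂ =
      All.lookup (All.lookup edges-disjoint e₁∈) e₂∈
        (SameEdge-trans (SameEdge-sym reports₁) (SameEdge-trans same reports₂))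

  ProperColoring-↭ : ∀ {E E′} {O O′ : List (ColoredEdge n k)} → E ↭ E′ → O ↭ O′ → ProperColoring E O → ProperColoring E′ O′
  ProperColoring-↭ E↭E′ O↭O′ proper = record
    { complete      = All-resp-↭ E↭E′ (All.map (Any-resp-↭ O↭O′) (complete proper))
    ; sound         = All-resp-↭ O↭O′ (All.map (Any-resp-↭ E↭E′) (sound proper))
    ; distinctEdges = AllPairs-resp-↭ (λ {o} {o′} → DistinctEdges-sym {x = o} {y = o′}) (resp₂ _) (↭⇒↭ₛ O↭O′) (distinctEdges proper)
    ; colorsDiffer  = AllPairs-resp-↭ ColorsDiffer-sym (resp₂ _) (↭⇒↭ₛ O↭O′) (colorsDiffer proper)
    }
    where open PermutationSetoid (setoid (ColoredEdge n k)) using (AllPairs-resp-↭)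

-- Two-sided arrival streams

MaxDegreeAtMost-⊆ : ∀ {n Δ} {E E′ : List (Edge n)} → E ⊆ E′ → MaxDegreeAtMost Δ E′ → MaxDegreeAtMost Δ E
MaxDegreeAtMost-⊆ E⊆E′ bound v =
  ≤-trans (Sublist.length-mono-≤ (Sublist.filter⁺ _ _ (λ { refl incident → incident }) E⊆E′)) (bound v)

opposite-≢ : ∀ t → opposite t ≢ t
opposite-≢ sideU ()
opposite-≢ sideV ()

≢sideU⇒≡sideV : ∀ {t} → t ≢ sideU → t ≡ sideV
≢sideU⇒≡sideV {sideU} t≢sideU = ⊥-elim (t≢sideU refl)
≢sideU⇒≡sideV {sideV} _       = refl

module _ {n : ℕ} where
  open ≡-Reasoning

  side : TwoArrival n → Side
  side (_ , t , _) = t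

  neighbours : TwoArrival n → List (Fin n)
  neighbours (_ , _ , ns) = ns

  forgetSide : TwoArrival n → OneArrival n
  forgetSide (w , _ , ns) = w , ns

  history : List (TwoArrival n) → List (Fin n × Side)
  history = map (λ a → proj₁ a , side a)

  onSideU? : Decidable (λ a → side a ≡ sideU)
  onSideU? (_ , sideU , _) = yes refl
  onSideU? (_ , sideV , _) = no λ ()

  edges₁-forgetSide : ∀ σ → edges₁ (map forgetSide σ) ≡ edges₂ σ
  edges₁-forgetSide σ = cong concat (sym (map-∘ σ))

  edges₂-filter : ∀ {P : Pred (TwoArrival n) 0ℓ} (P? : Decidable P) σ →
    Interleaving (edges₂ (filter P? σ)) (edges₂ (filter (¬? ∘ P?) σ)) (edges₂ σ)
  edges₂-filter P? []      = []
  edges₂-filter P? (a ∷ σ) with does (P? a)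
  ... | true  = prependˡ _ (edges₂-filter P? σ)
  ... | false = prependʳ _ (edges₂-filter P? σ)

  arrivals-fresh : ∀ {prev : List (Fin n × Side)} {σ} → ValidArrivals prev σ → All (λ a → proj₁ a ∉ map proj₁ prev) σ
  arrivals-fresh {σ = []}    _                     = []
  arrivals-fresh {σ = _ ∷ _} (w∉ , _ , _ , valid) =
    w∉ ∷ All.map (λ fresh → fresh ∘ ∈-map-++⁺ˡ proj₁) (arrivals-fresh valid)

  edges₂-sources-fresh : ∀ {prev : List (Fin n × Side)} {σ} → ValidArrivals prev σ → All (λ e → proj₁ e ∉ map proj₁ prev) (edges₂ σ)
  edges₂-sources-fresh valid =
    All.concat⁺ (All.map⁺ (All.map (λ fresh → All.map⁺ (All.universal (λ _ → fresh) _)) (arrivals-fresh valid)))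

  arrivals-unique : ∀ {prev : List (Fin n × Side)} {σ} → ValidArrivals prev σ → Unique (map proj₁ σ)
  arrivals-unique {σ = []}                _                 = []
  arrivals-unique {prev} {(w , t , _) ∷ σ} (_ , _ , _ , valid) =
    All.map⁺ (All.map (λ fresh w≡ → fresh (subst (_∈ _) w≡ (∈-map-++⁺ʳ proj₁ prev (here refl))))
                      (arrivals-fresh valid))
    ∷ arrivals-unique valid

  neighbours-unique : ∀ {prev : List (Fin n × Side)} {σ} → ValidArrivals prev σ → All (Unique ∘ neighbours) σ
  neighbours-unique {σ = []}    _                      = []
  neighbours-unique {σ = _ ∷ _} (_ , unique , _ , valid) = unique ∷ neighbours-unique valid

  neighbours-earlier : ∀ {prev : List (Fin n × Side)} {σ} → ValidArrivals prev σ →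
    All (λ a → All (λ v → (v , opposite (side a)) ∈ prev ++ history σ) (neighbours a)) σ
  neighbours-earlier {σ = []}              _                    = []
  neighbours-earlier {prev} {(w , t , _) ∷ σ} (_ , _ , earlier , valid) =
    All.map ∈-++⁺ˡ earlier
    ∷ All.map (All.map (subst (_ ∈_) (++-assoc prev ((w , t) ∷ []) (history σ)))) (neighbours-earlier valid)

  edges₂-simple : ∀ {prev : List (Fin n × Side)} {σ} → ValidArrivals prev σ →
    AllPairs (λ e e′ → ¬ SameEdge e e′) (edges₂ σ)
  edges₂-simple {σ = []} _ = []
  edges₂-simple {prev} {(w , t , _) ∷ σ} (_ , unique , earlier , valid) =
    AllPairs.++⁺ (AllPairs.map⁺ (AllPairs.map (λ v≢v′ same → v≢v′ (same-source same)) unique))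
                 (edges₂-simple valid)
                 (All.map⁺ (All.map (λ v-earlier → All.map (not-back-edge (∈-map⁺ proj₁ v-earlier))
                                                           (edges₂-sources-fresh valid))
                                    earlier))
    where
    same-source : ∀ {v v′} → SameEdge (w , v) (w , v′) → v ≡ v′
    same-source (inj₁ (_ , v≡v′))      = v≡v′
    same-source (inj₂ (w≡v′ , v≡w)) = trans v≡w w≡v′

    -- The source of a later edge arrives after w, hence is neither w nor a vertex of prev.
    not-back-edge : ∀ {v} {e : Edge n} → v ∈ map proj₁ prev →
      proj₁ e ∉ map proj₁ (prev ++ (w , t) ∷ []) → ¬ SameEdge (w , v) e
    not-back-edge v∈ fresh (inj₁ (refl , _)) = fresh (∈-map-++⁺ʳ proj₁ prev (here refl))
    not-back-edge v∈ fresh (inj₂ (_ , refl)) = fresh (∈-map-++⁺ˡ proj₁ v∈)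

  edges₂-filter-disjoint : ∀ {prev : List (Fin n × Side)} {σ} {P : Pred (TwoArrival n) 0ℓ} (P? : Decidable P) →
    ValidArrivals prev σ →
    All (λ e₁ → All (λ e₂ → ¬ SameEdge e₁ e₂) (edges₂ (filter (¬? ∘ P?) σ))) (edges₂ (filter P? σ))
  edges₂-filter-disjoint {σ = σ} P? valid =
    AllPairs-Interleaving⁻ (λ distinct same → distinct (SameEdge-sym same)) (edges₂-filter P? σ) (edges₂-simple valid)

  substream-valid : ∀ {Δ t σ} {P : Pred (TwoArrival n) 0ℓ} (P? : Decidable P) → ValidTwoSided Δ σ →
    All (λ a → side a ≡ t) (filter P? σ) → ValidOneSided Δ (map forgetSide (filter P? σ))
  substream-valid {Δ} {t} {σ} P? (valid , bounded) on-side =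
      AllPairs.map⁺ (AllPairs.map⁺ (AllPairs.filter⁺ P? (AllPairs.map⁻ (arrivals-unique valid))))
    , All.map⁺ (All.filter⁺ P? (neighbours-unique valid))
    , All.map⁺ (All.tabulate λ a∈ → All.tabulate λ v∈ → offline (proj₁ (∈-filter⁻ P? a∈)) (All.lookup on-side a∈) v∈)
    , MaxDegreeAtMost-⊆ (subst (_⊆ edges₂ σ) (sym (edges₁-forgetSide (filter P? σ)))
                                (Interleaving⇒⊆ˡ (edges₂-filter P? σ)))
                        bounded
    where
    offline : ∀ {a v} → a ∈ σ → side a ≡ t → v ∈ neighbours a → v ∉ map proj₁ (map forgetSide (filter P? σ))
    offline {a} {v} a∈σ a-on-side v∈ v-online
      with ∈-map⁻ _ (All.lookup (All.lookup (neighbours-earlier valid) a∈σ) v∈)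
         | find (Any.map⁻ (Any.map⁻ v-online))
    ... | b , b∈σ , v-earlier | c , c∈filter , v≡c = opposite-≢ t (begin
      opposite t         ≡⟨ cong opposite (sym a-on-side) ⟩
      opposite (side a)  ≡⟨ cong proj₂ v-earlier ⟩
      side b             ≡⟨ cong side b≡c ⟩
      side c             ≡⟨ All.lookup on-side c∈filter ⟩
      t                  ∎)
      where
      b≡c : b ≡ c
      b≡c = Unique-map⇒injective (arrivals-unique valid) b∈σ (proj₁ (∈-filter⁻ P? c∈filter))
              (trans (sym (cong proj₁ v-earlier)) v≡c)

  substream-proper : ∀ {k s Δ t σ} {A : OneSidedAlg n k s} {P : Pred (TwoArrival n) 0ℓ} (P? : Decidable P) →
    OneSidedCorrect Δ A → ValidTwoSided Δ σ → All (λ a → side a ≡ t) (filter P? σ) →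
    ProperColoring (edges₂ (filter P? σ)) (run A (map forgetSide (filter P? σ)))
  substream-proper {σ = σ} {A} P? correct valid on-side =
    subst (λ E → ProperColoring E (run A (map forgetSide (filter P? σ)))) (edges₁-forgetSide (filter P? σ))
      (ProperColoringOutput⇒ProperColoring (correct _ (substream-valid P? valid on-side)))

-- Two copies of a one-sided algorithm

module TwoSided {n k₁ k₂ s₁ s₂ : ℕ} (A₁ : OneSidedAlg n k₁ s₁) (A₂ : OneSidedAlg n k₂ s₂) where

  open Parallel onSideU? forgetSide (mapOutput (recolor (_↑ˡ k₂)) A₁) (mapOutput (recolor (k₁ ↑ʳ_)) A₂)

  algorithm : TwoSidedAlg n (k₁ + k₂) (s₁ + s₂)
  algorithm = parallel

  correct : ∀ {Δ} → OneSidedCorrect Δ A₁ → OneSidedCorrect Δ A₂ → TwoSidedCorrect Δ algorithm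
  correct correct₁ correct₂ σ valid =
    ProperColoring⇒ProperColoringOutput
      (ProperColoring-↭ (↭-sym (toPermutation (edges₂-filter onSideU? σ))) (↭-sym (toPermutation outputs))
        (ProperColoring-++ proper₁ proper₂ (edges₂-filter-disjoint onSideU? (proj₁ valid)) colors-disjoint))
    where
    σ₁ = filter onSideU? σ
    σ₂ = filter (¬? ∘ onSideU?) σ
    O₁ = run A₁ (map forgetSide σ₁)
    O₂ = run A₂ (map forgetSide σ₂)

    proper₁ : ProperColoring (edges₂ σ₁) (map (recolor (_↑ˡ k₂)) O₁)
    proper₁ = ProperColoring-recolor (↑ˡ-injective k₂ _ _)
      (substream-proper onSideU? correct₁ valid (All.all-filter onSideU? σ))

    proper₂ : ProperColoring (edges₂ σ₂) (map (recolor (k₁ ↑ʳ_)) O₂)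
    proper₂ = ProperColoring-recolor (↑ʳ-injective k₁ _ _)
      (substream-proper (¬? ∘ onSideU?) correct₂ valid (All.map ≢sideU⇒≡sideV (All.all-filter (¬? ∘ onSideU?) σ)))

    colors-disjoint : All (λ o₁ → All (λ o₂ → color o₁ ≢ color o₂) (map (recolor (k₁ ↑ʳ_)) O₂))
                          (map (recolor (_↑ˡ k₂)) O₁)
    colors-disjoint = All.map⁺ (All.universal (λ o₁ → All.map⁺ (All.universal (λ o₂ → ↑ˡ≢↑ʳ (color o₁) (color o₂)) O₂)) O₁)

    outputs : Interleaving (map (recolor (_↑ˡ k₂)) O₁) (map (recolor (k₁ ↑ʳ_)) O₂) (run algorithm σ)
    outputs = subst₂ (λ l r → Interleaving l r (run algorithm σ))
      (runFrom-mapOutput _ A₁ (init A₁) (map forgetSide σ₁)) (runFrom-mapOutput _ A₂ (init A₂) (map forgetSide σ₂))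
      (runFrom-parallel (init A₁) (init A₂) σ)

TwoSidedCorrect-pad : ∀ {n k s Δ} t (B : TwoSidedAlg n k s) → TwoSidedCorrect Δ B → TwoSidedCorrect Δ (pad t B)
TwoSidedCorrect-pad t B correct σ valid =
  subst (ProperColoringOutput (edges₂ σ)) (sym (runFrom-pad t B (init B) (replicate t false) σ)) (correct σ valid)

m+m≡2*m : ∀ m → m + m ≡ 2 * m
m+m≡2*m m = cong (m +_) (sym (+-identityʳ m))

claim3p2 : (f : ℕ → ℕ) (s : ℕ → ℕ → ℕ)
    → ((n Δ : ℕ) → Σ (OneSidedAlg n (f Δ) (s n Δ)) (OneSidedCorrect Δ))
    → Σ ℕ (λ C → (n Δ : ℕ) →
        Σ (TwoSidedAlg n (2 * f Δ) (C * s n Δ + C)) (TwoSidedCorrect Δ))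
claim3p2 f s one-sided = 2 , two-sided
  where
  -- two spare bits bring the s + s bits of the two copies to the shape C * s + C
  two-sided : (n Δ : ℕ) → Σ (TwoSidedAlg n (2 * f Δ) (2 * s n Δ + 2)) (TwoSidedCorrect Δ)
  two-sided n Δ with one-sided n Δ
  ... | A , correct = subst₂ (λ k m → Σ (TwoSidedAlg n k m) (TwoSidedCorrect Δ))
                             (m+m≡2*m (f Δ)) (cong (_+ 2) (m+m≡2*m (s n Δ)))
                             (pad 2 algorithm , TwoSidedCorrect-pad 2 algorithm (TwoSided.correct A A correct correct))
    where open TwoSided A A using (algorithm)
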